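{- Let $q$ be a prime power with $q-1=ml^2$ for integers $l,m\ge 2$. Let $\theta$ be a primitive element of $\mathbb{F}_q$, put $\beta=\theta^l$, $C=\langle\beta^m\rangle=\langle\theta^{ml}\rangle\le\mathbb{F}_q^*$, $H=\langle\beta\rangle\le\mathbb{F}_q^*$, and $A_j=\beta^jC$ for $0\le j\le m-1$. Then for any $c\in\{1,\dots,m-1\}$, the family $\{A_0,\dots,A_{m-1}\}$ is a $(q,m,l;1)$-$c$-CEDF in $(\mathbb{F}_q,+)$ if and only if $$\{x-1:\ x\in A_c\}=\{\beta^{c+km}-1:\ 0\le k\le l-1\}$$ is a complete set of coset representatives of $H$ in $\mathbb{F}_q^*$. Moreover, if $l=2$ (so $q=4m+1$ and $\beta=\theta^2$), then for any $c\in\{1,\dots,m-1\}$, the family $\{A_0,\dots,A_{m-1}\}$ is a $(q,m,2;1)$-$c$-CEDF in $(\mathbb{F}_q,+)$ if and only if $\theta^{4c}-1$ is a non-square element of $\mathbb{F}_q^*$.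
   Context: Let $(G,+)$ be a finite abelian group of order $n$ (written additively), let $l,m\ge 2$, and let $S$ be a non-empty subset of $\{1,\dots,m-1\}$. For non-empty subsets $A,B\subseteq G$, $\Delta(A,B)$ denotes the multiset $\{\{a-b: a\in A, b\in B\}\}$. A family $\{A_0,\dots,A_{m-1}\}$ of $m$ pairwise disjoint subsets of $G$ is an $(n,m,l;\lambda)$-$S$-circular external difference family (CEDF) in $G$ if $|A_i|=l$ for all $i$ and each nonzero $g\in G$ occurs exactly $\lambda$ times in the multiset union $\bigcup_{c\in S}\bigcup_{i=0}^{m-1}\Delta(A_{i+c},A_i)$, where subscripts are taken modulo $m$. When $S=\{c\}$ this is called an $(n,m,l;\lambda)$-$c$-CEDF. -}

module Defs where

open import Level using (0ℓ)
open import Data.Nat using (ℕ; zero; suc)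
import Data.Nat as ℕ
open import Data.Nat.ListAction using (sum)
open import Data.Nat.DivMod using (_mod_)
open import Data.Bool using (Bool; true; false; if_then_else_; _∧_)
open import Data.Fin using (Fin; toℕ)
open import Data.List using (List; map; allFin; upTo)
open import Data.Bool.ListAction using (any)
open import Data.Product using (Σ; _×_)
open import Algebra.Structures using (IsAbelianGroup; IsCommutativeRing)
open import Function.Bundles using (_↔_; Inverse)
open import Relation.Binary.Definitions using (DecidableEquality)
open import Relation.Binary.PropositionalEquality using (_≡_; _≢_)
open import Relation.Nullary.Decidable using (⌊_⌋)

count : {n : ℕ} → (Fin n → Bool) → ℕ
count {n} P = sum (map (λ i → if P i then 1 else 0) (allFin n))

sumFin : {n : ℕ} → (Fin n → ℕ) → ℕ
sumFin {n} f = sum (map f (allFin n))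

record FinAbGroup (n : ℕ) : Set₁ where
  infixl 6 _+_
  field
    Carrier        : Set
    _+_            : Carrier → Carrier → Carrier
    -_             : Carrier → Carrier
    0#             : Carrier
    isAbelianGroup : IsAbelianGroup _≡_ _+_ 0# -_
    _≟_            : DecidableEquality Carrier
    enum           : Fin n ↔ Carrier

  elt : Fin n → Carrier
  elt = Inverse.to enum

  _-_ : Carrier → Carrier → Carrier
  a - b = a + (- b)

-- Subsets of G are given by characteristic functions Carrier → Bool.
-- Index (i + c) mod m in Fin m.
shift : (m : ℕ) → ℕ → Fin m → Fin m
shift zero    c ()
shift (suc k) c i = (toℕ i ℕ.+ c) mod (suc k)

-- Multiplicity of g in the multiset union ⋃_i Δ(A_{i+c}, A_i).
cOcc : {n : ℕ} (G : FinAbGroup n) (m c : ℕ) →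
       (Fin m → FinAbGroup.Carrier G → Bool) → FinAbGroup.Carrier G → ℕ
cOcc G m c A g = sumFin (λ i → sumFin (λ a → count (λ b →
    A (shift m c i) (elt a) ∧ A i (elt b) ∧ ⌊ (elt a - elt b) ≟ g ⌋)))
  where open FinAbGroup G

IsCCEDF : {n : ℕ} (G : FinAbGroup n) (m l λ' c : ℕ) →
          (Fin m → FinAbGroup.Carrier G → Bool) → Set
IsCCEDF {n} G m l λ' c A =
    (∀ i j x → i ≢ j → A i x ≡ true → A j x ≡ false)
  × (∀ i → count (λ k → A i (elt k)) ≡ l)
  × (∀ g → g ≢ 0# → cOcc G m c A g ≡ λ')
  where open FinAbGroup G

record FiniteField (q : ℕ) : Set₁ where
  infixl 6 _+_
  infixl 7 _*_
  field
    Carrier           : Set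
    _+_ _*_           : Carrier → Carrier → Carrier
    -_                : Carrier → Carrier
    0# 1#             : Carrier
    isCommutativeRing : IsCommutativeRing _≡_ _+_ _*_ -_ 0# 1#
    0≢1               : 0# ≢ 1#
    inverse           : ∀ x → x ≢ 0# → Σ Carrier (λ y → x * y ≡ 1#)
    _≟_               : DecidableEquality Carrier
    enum              : Fin q ↔ Carrier

  elt : Fin q → Carrier
  elt = Inverse.to enum

  _-_ : Carrier → Carrier → Carrier
  a - b = a + (- b)

  _^_ : Carrier → ℕ → Carrier
  x ^ zero  = 1#
  x ^ suc k = x * (x ^ k)

  Primitive : Carrier → Set
  Primitive θ = θ ≢ 0# × (∀ x → x ≢ 0# → Σ ℕ (λ k → θ ^ k ≡ x))

  -- characteristic function of the cyclic subgroup ⟨g⟩ of F_q^*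
  -- (in a group of order < q every element of ⟨g⟩ is g^k with k < q).
  ⟨_⟩ : Carrier → Carrier → Bool
  ⟨ g ⟩ x = any (λ k → ⌊ x ≟ (g ^ k) ⌋) (upTo q)

  coset : Carrier → (Carrier → Bool) → Carrier → Bool
  coset y H x = any (λ i → H (elt i) ∧ ⌊ x ≟ (y * elt i) ⌋) (allFin q)

  CompleteCosetReps : (Carrier → Bool) → (Carrier → Bool) → Set
  CompleteCosetReps H R =
      (∀ x → R x ≡ true → x ≢ 0#)
    × (∀ y → y ≢ 0# → count (λ i → R (elt i) ∧ coset y H (elt i)) ≡ 1)

  NonSquare : Carrier → Set
  NonSquare x = x ≢ 0# × (∀ y → y * y ≢ x)

  additiveGroup : FinAbGroup q
  additiveGroup = record
    { Carrier = Carrier ; _+_ = _+_ ; -_ = -_ ; 0# = 0#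
    ; isAbelianGroup = IsCommutativeRing.+-isAbelianGroup isCommutativeRing
    ; _≟_ = _≟_ ; enum = enum }

  Afam : (m l : ℕ) → Carrier → Fin m → Carrier → Bool
  Afam m l θ j x =
    any (λ i → ⟨ (θ ^ l) ^ m ⟩ (elt i) ∧ ⌊ x ≟ ((θ ^ l) ^ toℕ j * elt i) ⌋) (allFin q)

{-# OPTIONS --safe #-}
-- Write β = θ^l and γ = β^m.  As θ has order q - 1 = l·(ml), the sets A_j = β^j⟨γ⟩ (j < m)
-- are the m cosets of the subgroup ⟨γ⟩ (of order l) in H = ⟨β⟩, and A_i·A_j = A_(i+j mod m).
-- Hence, for b ∈ A_i, g + b ∈ A_(i+c) iff (g + b)/b = g/b + 1 ∈ A_c, while b lies in H
-- exactly when g/b lies in gH.  Substituting x = g/b, the number of ways to write g ≠ 0 as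
-- a - b with a ∈ A_(i+c), b ∈ A_i (for some i) is the number of x ∈ gH with x + 1 ∈ A_c,
-- i.e. the number of elements of {y - 1 : y ∈ A_c} in the coset gH.
-- For l = 2 we have γ = -1 and H is the group of non-zero squares, so {u - 1, -u - 1}
-- (u = θ^2c) contains one element of each square class iff (u - 1)(-u - 1) = -(θ^4c - 1)
-- is a non-square; and -1 = (θ^m)² is a square.
module Submission where

open import Defs
open import Data.Nat using (ℕ; _≤_; _<_; _∸_; zero; suc; NonZero)
import Data.Nat as ℕ
open import Data.Fin using (Fin; toℕ; punchIn; punchOut; fromℕ<)
open import Data.Product using (_×_; ∃-syntax; _,_; proj₁; proj₂)
open import Function.Bundles using (_⇔_; Inverse; _↔_; mk⇔; Equivalence)
open import Relation.Binary.PropositionalEquality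
  using (_≡_; _≢_; refl; sym; trans; cong; cong₂; subst; subst₂; module ≡-Reasoning)
open import Level using (0ℓ)
open import Algebra.Bundles using (CommutativeRing; Group)
open import Algebra.Structures using (IsAbelianGroup)
open import Data.Bool using (Bool; true; false; if_then_else_; _∧_)
import Data.Bool as Bool
open import Data.Bool.Properties using (∧-zeroʳ; ∧-identityʳ; ∧-conicalˡ; ∧-conicalʳ; T-≡; ⇔→≡; ¬-not)
open import Data.Bool.ListAction using (any)
open import Data.Fin.Patterns using (0F; 1F)
import Data.Fin.Properties as Fin
open import Data.Fin.Permutation using (permutation)
open import Data.List using (tabulate; allFin; upTo)
open import Data.List.Properties using (map-tabulate)
open import Data.List.Membership.Propositional using (_∈_; find; lose)
open import Data.List.Membership.Propositional.Properties using (∈-allFin; ∈-upTo⁺)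
open import Data.List.Relation.Unary.Any.Properties using (any⁺; any⁻)
open import Data.Nat.DivMod
  using (_%_; _/_; m≡m%n+[m/n]*n; m%n<n; m<n⇒m%n≡m; %-distribˡ-+; [m+kn]%n≡m%n; %-remove-+ʳ; m∣n⇒o%n%m≡o%m)
open import Data.Nat.Divisibility using (_∣_; m∣m*n)
import Data.Nat.ListAction as List
import Data.Nat.Properties as ℕ
open import Data.Nat.Tactic.RingSolver using (solve-∀)
open import Data.Sum using (_⊎_; inj₁; inj₂)
open import Function using (_∘_; id)
open import Function.Definitions using (Injective)
open import Function.Properties.Equivalence using () renaming (trans to ⇔-trans)
open import Relation.Binary.Definitions using (DecidableEquality)
open import Relation.Nullary using (¬_; contradiction; yes; no)
open import Relation.Nullary.Decidable using (Dec; ⌊_⌋; isYes≗does; dec-true; dec-false; toWitness)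
open import Algebra.Properties.CommutativeMonoid.Sum ℕ.+-0-commutativeMonoid
  using (sum-syntax; ∑-comm; ∑-permute; sum-remove; sum-cong-≗; sum-replicate-zero)

⌊⌋-yes : ∀ {A : Set} (a? : Dec A) → A → ⌊ a? ⌋ ≡ true
⌊⌋-yes a? a = trans (isYes≗does a?) (dec-true a? a)

⌊⌋-no : ∀ {A : Set} (a? : Dec A) → ¬ A → ⌊ a? ⌋ ≡ false
⌊⌋-no a? ¬a = trans (isYes≗does a?) (dec-false a? ¬a)

⌊⌋-witness : ∀ {A : Set} {a? : Dec A} → ⌊ a? ⌋ ≡ true → A
⌊⌋-witness = toWitness ∘ Equivalence.from T-≡

any≡true⇔ : ∀ {A : Set} (p : A → Bool) xs → any p xs ≡ true ⇔ (∃[ x ] x ∈ xs × p x ≡ true)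
any≡true⇔ p xs = mk⇔
  (λ h → let x , x∈xs , px = find (any⁻ p xs (Equivalence.from T-≡ h)) in x , x∈xs , Equivalence.to T-≡ px)
  (λ (x , x∈xs , px) → Equivalence.to T-≡ (any⁺ p (lose x∈xs (Equivalence.from T-≡ px))))

𝟙 : Bool → ℕ
𝟙 b = if b then 1 else 0

𝟙-∧-falseˡ : ∀ {x} y → x ≡ false → 𝟙 (x ∧ y) ≡ 0
𝟙-∧-falseˡ y refl = refl

𝟙-∧-falseʳ : ∀ x {y} → y ≡ false → 𝟙 (x ∧ y) ≡ 0
𝟙-∧-falseʳ x refl = cong 𝟙 (∧-zeroʳ x)

sumFin≡∑ : ∀ {n} (f : Fin n → ℕ) → sumFin f ≡ ∑[ i < n ] f i
sumFin≡∑ f = trans (cong List.sum (map-tabulate id f)) (sum-tabulate f)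
  where
  sum-tabulate : ∀ {n} (f : Fin n → ℕ) → List.sum (tabulate f) ≡ ∑[ i < n ] f i
  sum-tabulate {zero}  f = refl
  sum-tabulate {suc n} f = cong (f 0F ℕ.+_) (sum-tabulate (f ∘ Fin.suc))

∑-zero : ∀ {n} {f : Fin n → ℕ} → (∀ i → f i ≡ 0) → ∑[ i < n ] f i ≡ 0
∑-zero {n} f≗0 = trans (sum-cong-≗ f≗0) (sum-replicate-zero n)

∑-δ : ∀ {n} {f : Fin n → ℕ} i → (∀ j → j ≢ i → f j ≡ 0) → ∑[ j < n ] f j ≡ f i
∑-δ {suc n} {f} i f≗0 = begin
  ∑[ j < suc n ] f j                  ≡⟨ sum-remove f ⟩
  f i ℕ.+ ∑[ j < n ] f (punchIn i j)  ≡⟨ cong (f i ℕ.+_) (∑-zero (λ j → f≗0 _ (Fin.punchInᵢ≢i i j))) ⟩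
  f i ℕ.+ 0                           ≡⟨ ℕ.+-identityʳ (f i) ⟩
  f i                                 ∎
  where open ≡-Reasoning

∑-1 : ∀ n → ∑[ i < n ] 1 ≡ n
∑-1 zero    = refl
∑-1 (suc n) = cong suc (∑-1 n)

m%d≡n%d⇒[m+o]%d≡[n+o]%d : ∀ {d} .{{_ : NonZero d}} m n o → m % d ≡ n % d → (m ℕ.+ o) % d ≡ (n ℕ.+ o) % d
m%d≡n%d⇒[m+o]%d≡[n+o]%d {d} m n o eq =
  trans (%-distribˡ-+ m o d) (trans (cong (λ r → (r ℕ.+ o % d) % d) eq) (sym (%-distribˡ-+ n o d)))

%-cancelˡ-+ : ∀ d .{{_ : NonZero d}} i j k → (i ℕ.+ j) % d ≡ (i ℕ.+ k) % d → j % d ≡ k % d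
%-cancelˡ-+ d@(suc d-1) i j k eq = begin
  j % d                          ≡⟨ [m+kn]%n≡m%n j i d ⟨
  (j ℕ.+ i ℕ.* d) % d            ≡⟨ cong (_% d) (regroup d-1 i j) ⟩
  (i ℕ.+ j ℕ.+ d-1 ℕ.* i) % d    ≡⟨ m%d≡n%d⇒[m+o]%d≡[n+o]%d (i ℕ.+ j) (i ℕ.+ k) (d-1 ℕ.* i) eq ⟩
  (i ℕ.+ k ℕ.+ d-1 ℕ.* i) % d    ≡⟨ cong (_% d) (regroup d-1 i k) ⟨
  (k ℕ.+ i ℕ.* d) % d            ≡⟨ [m+kn]%n≡m%n k i d ⟩
  k % d                          ∎
  where
  open ≡-Reasoning
  regroup : ∀ d-1 i x → x ℕ.+ i ℕ.* suc d-1 ≡ i ℕ.+ x ℕ.+ d-1 ℕ.* i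
  regroup = solve-∀

low-digit-unique : ∀ {m n} .{{_ : NonZero m}} .{{_ : NonZero n}} → m ∣ n → ∀ {i j k k′} → i < m → j < m →
                   (i ℕ.+ m ℕ.* k) % n ≡ (j ℕ.+ m ℕ.* k′) % n → i ≡ j
low-digit-unique {m} {n} m∣n {i} {j} {k} {k′} i<m j<m eq = begin
  i                          ≡⟨ m<n⇒m%n≡m i<m ⟨
  i % m                      ≡⟨ %-remove-+ʳ i (m∣m*n k) ⟨
  (i ℕ.+ m ℕ.* k) % m        ≡⟨ m∣n⇒o%n%m≡o%m m n _ m∣n ⟨
  (i ℕ.+ m ℕ.* k) % n % m    ≡⟨ cong (_% m) eq ⟩
  (j ℕ.+ m ℕ.* k′) % n % m   ≡⟨ m∣n⇒o%n%m≡o%m m n _ m∣n ⟩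
  (j ℕ.+ m ℕ.* k′) % m       ≡⟨ %-remove-+ʳ j (m∣m*n k′) ⟩
  j % m                      ≡⟨ m<n⇒m%n≡m j<m ⟩
  j                          ∎
  where open ≡-Reasoning

toℕ-shift : ∀ m .{{_ : NonZero m}} c (i : Fin m) → toℕ (shift m c i) ≡ (toℕ i ℕ.+ c) % m
toℕ-shift (suc m) c i = Fin.toℕ-fromℕ< _

module Enumeration {n} {C : Set} (enum : Fin n ↔ C) where

  open Inverse enum using (from; strictlyInverseˡ; strictlyInverseʳ) renaming (to to elt)

  elt-injective : ∀ {i j} → elt i ≡ elt j → i ≡ j
  elt-injective {i} {j} eq = trans (sym (strictlyInverseʳ i)) (trans (cong from eq) (strictlyInverseʳ j))

  ∑-δ-elt : (f : C → ℕ) (a : C) → (∀ x → x ≢ a → f x ≡ 0) → ∑[ i < n ] f (elt i) ≡ f a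
  ∑-δ-elt f a f≗0 = trans (∑-δ (from a) f∘elt≗0) (cong f (strictlyInverseˡ a))
    where
    f∘elt≗0 : ∀ i → i ≢ from a → f (elt i) ≡ 0
    f∘elt≗0 i i≢ = f≗0 (elt i) (λ eq → i≢ (elt-injective (trans eq (sym (strictlyInverseˡ a)))))

  ∑-involution : (σ : C → C) → (∀ x → σ (σ x) ≡ x) → (f : C → ℕ) →
                 ∑[ i < n ] f (σ (elt i)) ≡ ∑[ i < n ] f (elt i)
  ∑-involution σ σ-involutive f =
    sym (trans (∑-permute (f ∘ elt) π) (sum-cong-≗ (cong f ∘ strictlyInverseˡ ∘ σ ∘ elt)))
    where
    π̂ : Fin n → Fin n
    π̂ = from ∘ σ ∘ elt
    π̂-involutive : ∀ i → π̂ (π̂ i) ≡ i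
    π̂-involutive i = trans (cong (from ∘ σ) (strictlyInverseˡ (σ (elt i))))
                           (trans (cong from (σ-involutive (elt i))) (strictlyInverseʳ i))
    π = permutation π̂ π̂ π̂-involutive π̂-involutive

  module _ (_≟_ : DecidableEquality C) where

    ∑-image : ∀ {k} (f : Fin k → C) → Injective _≡_ _≡_ f → (P Q : C → Bool) →
              (∀ x → P x ≡ true ⇔ (∃[ t ] f t ≡ x)) →
              ∑[ i < n ] 𝟙 (P (elt i) ∧ Q (elt i)) ≡ ∑[ t < k ] 𝟙 (Q (f t))
    ∑-image {k} f f-injective P Q P⇔image = begin
      ∑[ i < n ] 𝟙 (P (elt i) ∧ Q (elt i))
        ≡⟨ sum-cong-≗ (λ i → by-cases (elt i) (P (elt i)) refl) ⟩
      ∑[ i < n ] ∑[ t < k ] 𝟙 (⌊ f t ≟ elt i ⌋ ∧ Q (elt i))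
        ≡⟨ ∑-comm (λ i t → 𝟙 (⌊ f t ≟ elt i ⌋ ∧ Q (elt i))) ⟩
      ∑[ t < k ] ∑[ i < n ] 𝟙 (⌊ f t ≟ elt i ⌋ ∧ Q (elt i))
        ≡⟨ sum-cong-≗ (λ t → ∑-δ-elt (λ x → 𝟙 (⌊ f t ≟ x ⌋ ∧ Q x)) (f t)
             (λ x x≢ft → 𝟙-∧-falseˡ _ (⌊⌋-no (f t ≟ x) (x≢ft ∘ sym)))) ⟩
      ∑[ t < k ] 𝟙 (⌊ f t ≟ f t ⌋ ∧ Q (f t))
        ≡⟨ sum-cong-≗ (λ t → cong (λ b → 𝟙 (b ∧ Q (f t))) (⌊⌋-yes (f t ≟ f t) refl)) ⟩
      ∑[ t < k ] 𝟙 (Q (f t))                               ∎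
      where
      open ≡-Reasoning
      by-cases : ∀ x b → P x ≡ b → 𝟙 (b ∧ Q x) ≡ ∑[ t < k ] 𝟙 (⌊ f t ≟ x ⌋ ∧ Q x)
      by-cases x true  Px = let t₀ , ft₀≡x = Equivalence.to (P⇔image x) Px in sym (begin
        ∑[ t < k ] 𝟙 (⌊ f t ≟ x ⌋ ∧ Q x)
          ≡⟨ ∑-δ t₀ (λ t t≢t₀ → 𝟙-∧-falseˡ _ (⌊⌋-no (f t ≟ x)
               (λ ft≡x → t≢t₀ (f-injective (trans ft≡x (sym ft₀≡x)))))) ⟩
        𝟙 (⌊ f t₀ ≟ x ⌋ ∧ Q x)
          ≡⟨ cong (λ b → 𝟙 (b ∧ Q x)) (⌊⌋-yes (f t₀ ≟ x) ft₀≡x) ⟩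
        𝟙 (true ∧ Q x)                   ∎)
      by-cases x false Px = sym (∑-zero (λ t → 𝟙-∧-falseˡ _ (⌊⌋-no (f t ≟ x) (λ ft≡x →
        contradiction (trans (sym Px) (Equivalence.from (P⇔image x) (t , ft≡x))) λ ()))))

module _ {n} (G : FinAbGroup n) where

  open FinAbGroup G
  open Enumeration enum using (∑-δ-elt)

  private
    group : Group 0ℓ 0ℓ
    group = record { isGroup = IsAbelianGroup.isGroup isAbelianGroup }
  open import Algebra.Properties.Group group using (//-rightDividesˡ; //-rightDividesʳ)

  cOcc≡∑∑ : ∀ m c (A : Fin m → Carrier → Bool) g →
            cOcc G m c A g ≡ ∑[ b < n ] ∑[ i < m ] 𝟙 (A (shift m c i) (g + elt b) ∧ A i (elt b))
  cOcc≡∑∑ m c A g = begin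
    cOcc G m c A g
      ≡⟨ trans (sumFin≡∑ (λ i → sumFin (λ a → count (pair i a))))
               (sum-cong-≗ (λ i → trans (sumFin≡∑ (λ a → count (pair i a)))
                                        (sum-cong-≗ (λ a → sumFin≡∑ (𝟙 ∘ pair i a))))) ⟩
    ∑[ i < m ] ∑[ a < n ] ∑[ b < n ] 𝟙 (pair i a b)
      ≡⟨ sum-cong-≗ (λ i → ∑-comm (λ a b → 𝟙 (pair i a b))) ⟩
    ∑[ i < m ] ∑[ b < n ] ∑[ a < n ] 𝟙 (pair i a b)
      ≡⟨ sum-cong-≗ (λ i → sum-cong-≗ (λ b → ∑-δ-elt _ (g + elt b) (off-diagonal i b))) ⟩
    ∑[ i < m ] ∑[ b < n ] 𝟙 (A (shift m c i) (g + elt b) ∧ A i (elt b) ∧ ⌊ ((g + elt b) - elt b) ≟ g ⌋)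
      ≡⟨ sum-cong-≗ (λ i → sum-cong-≗ (λ b →
           cong (λ t → 𝟙 (A (shift m c i) (g + elt b) ∧ t)) (diagonal i b))) ⟩
    ∑[ i < m ] ∑[ b < n ] 𝟙 (A (shift m c i) (g + elt b) ∧ A i (elt b))
      ≡⟨ ∑-comm (λ i b → 𝟙 (A (shift m c i) (g + elt b) ∧ A i (elt b))) ⟩
    ∑[ b < n ] ∑[ i < m ] 𝟙 (A (shift m c i) (g + elt b) ∧ A i (elt b)) ∎
    where
    open ≡-Reasoning
    pair : Fin m → Fin n → Fin n → Bool
    pair i a b = A (shift m c i) (elt a) ∧ A i (elt b) ∧ ⌊ (elt a - elt b) ≟ g ⌋
    off-diagonal : ∀ i b x → x ≢ g + elt b → 𝟙 (A (shift m c i) x ∧ A i (elt b) ∧ ⌊ (x - elt b) ≟ g ⌋) ≡ 0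
    off-diagonal i b x x≢g+b = 𝟙-∧-falseʳ (A (shift m c i) x)
      (trans (cong (A i (elt b) ∧_) (⌊⌋-no ((x - elt b) ≟ g) (x≢g+b ∘ x-b≡g⇒x≡g+b))) (∧-zeroʳ _))
      where
      x-b≡g⇒x≡g+b : x - elt b ≡ g → x ≡ g + elt b
      x-b≡g⇒x≡g+b eq = trans (sym (//-rightDividesˡ (elt b) x)) (cong (_+ elt b) eq)
    diagonal : ∀ i b → (A i (elt b) ∧ ⌊ ((g + elt b) - elt b) ≟ g ⌋) ≡ A i (elt b)
    diagonal i b = trans (cong (A i (elt b) ∧_) (⌊⌋-yes (_ ≟ g) (//-rightDividesʳ (elt b) g))) (∧-identityʳ _)

module FiniteFieldProperties {q} (F : FiniteField q) where

  open FiniteField F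

  commutativeRing : CommutativeRing 0ℓ 0ℓ
  commutativeRing = record { isCommutativeRing = isCommutativeRing }

  open CommutativeRing commutativeRing public
    using (+-identityˡ; +-identityʳ; +-comm; *-assoc; *-comm; *-identityˡ; *-identityʳ; zeroˡ; zeroʳ; distribʳ; +-group)
  open CommutativeRing commutativeRing using (semiring; commutativeSemiring)
  open import Algebra.Properties.Semiring.Exp semiring
    using () renaming (_^_ to _^ᴿ_; ^-homo-* to ^ᴿ-homo-*; ^-assocʳ to ^ᴿ-assocʳ)
  open import Algebra.Solver.Ring.NaturalCoefficients.Default commutativeSemiring public
    using (solve; _:+_; _:*_; _:=_)
  open ≡-Reasoning

  ^≡^ᴿ : ∀ x n → x ^ n ≡ x ^ᴿ n
  ^≡^ᴿ x zero    = refl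
  ^≡^ᴿ x (suc n) = cong (x *_) (^≡^ᴿ x n)

  ^-+ : ∀ x a b → x ^ (a ℕ.+ b) ≡ x ^ a * x ^ b
  ^-+ x a b rewrite ^≡^ᴿ x (a ℕ.+ b) | ^≡^ᴿ x a | ^≡^ᴿ x b = ^ᴿ-homo-* x a b

  ^-* : ∀ x a b → x ^ (a ℕ.* b) ≡ (x ^ a) ^ b
  ^-* x a b rewrite ^≡^ᴿ (x ^ a) b | ^≡^ᴿ x a | ^≡^ᴿ x (a ℕ.* b) = sym (^ᴿ-assocʳ x a b)

  1^ : ∀ n → 1# ^ n ≡ 1#
  1^ zero    = refl
  1^ (suc n) = trans (*-identityˡ _) (1^ n)

  ^-% : ∀ {x n} .{{_ : NonZero n}} → x ^ n ≡ 1# → ∀ a → x ^ a ≡ x ^ (a % n)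
  ^-% {x} {n} xⁿ≡1 a = begin
    x ^ a
      ≡⟨ cong (x ^_) (trans (m≡m%n+[m/n]*n a n) (cong (a % n ℕ.+_) (ℕ.*-comm (a / n) n))) ⟩
    x ^ (a % n ℕ.+ n ℕ.* (a / n))
      ≡⟨ trans (^-+ x (a % n) _) (cong (x ^ (a % n) *_) (^-* x n (a / n))) ⟩
    x ^ (a % n) * (x ^ n) ^ (a / n)
      ≡⟨ cong (λ y → x ^ (a % n) * y ^ (a / n)) xⁿ≡1 ⟩
    x ^ (a % n) * 1# ^ (a / n)
      ≡⟨ trans (cong (x ^ (a % n) *_) (1^ (a / n))) (*-identityʳ _) ⟩
    x ^ (a % n) ∎

  -- Extended by 0 ⁻¹ = 0, so that b ↦ g * b ⁻¹ is an involution of the whole field.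
  _⁻¹ : Carrier → Carrier
  x ⁻¹ with x ≟ 0#
  ... | yes _  = 0#
  ... | no x≢0 = proj₁ (inverse x x≢0)

  *-inverseʳ : ∀ {x} → x ≢ 0# → x * x ⁻¹ ≡ 1#
  *-inverseʳ {x} x≢0 with x ≟ 0#
  ... | yes x≡0  = contradiction x≡0 x≢0
  ... | no x≢0′ = proj₂ (inverse x x≢0′)

  0⁻¹ : 0# ⁻¹ ≡ 0#
  0⁻¹ with 0# ≟ 0#
  ... | yes _  = refl
  ... | no 0≢0 = contradiction refl 0≢0

  ⁻¹-cancelˡ : ∀ {x} → x ≢ 0# → ∀ y → x ⁻¹ * (x * y) ≡ y
  ⁻¹-cancelˡ {x} x≢0 y = begin
    x ⁻¹ * (x * y)  ≡⟨ *-assoc _ _ _ ⟨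
    x ⁻¹ * x * y    ≡⟨ cong (_* y) (trans (*-comm _ _) (*-inverseʳ x≢0)) ⟩
    1# * y          ≡⟨ *-identityˡ y ⟩
    y               ∎

  *-cancelˡ : ∀ {x y z} → x ≢ 0# → x * y ≡ x * z → y ≡ z
  *-cancelˡ {x} {y} {z} x≢0 eq =
    trans (sym (⁻¹-cancelˡ x≢0 y)) (trans (cong (x ⁻¹ *_) eq) (⁻¹-cancelˡ x≢0 z))

  *-≢0 : ∀ {x y} → x ≢ 0# → y ≢ 0# → x * y ≢ 0#
  *-≢0 {x} x≢0 y≢0 xy≡0 = y≢0 (*-cancelˡ x≢0 (trans xy≡0 (sym (zeroʳ x))))

  ^-≢0 : ∀ {x} → x ≢ 0# → ∀ n → x ^ n ≢ 0#
  ^-≢0 x≢0 zero    = 0≢1 ∘ sym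
  ^-≢0 x≢0 (suc n) = *-≢0 x≢0 (^-≢0 x≢0 n)

  ⁻¹-unique : ∀ {x y} → x * y ≡ 1# → x ⁻¹ ≡ y
  ⁻¹-unique {x} {y} xy≡1 =
    trans (sym (*-identityʳ _)) (trans (cong (x ⁻¹ *_) (sym xy≡1)) (⁻¹-cancelˡ x≢0 y))
    where
    x≢0 : x ≢ 0#
    x≢0 x≡0 = 0≢1 (trans (sym (zeroˡ y)) (trans (cong (_* y) (sym x≡0)) xy≡1))

  ⁻¹-involutive : ∀ x → x ⁻¹ ⁻¹ ≡ x
  ⁻¹-involutive x = by-cases (x ≟ 0#)
    where
    by-cases : Dec (x ≡ 0#) → x ⁻¹ ⁻¹ ≡ x
    by-cases (yes refl) = trans (cong _⁻¹ 0⁻¹) 0⁻¹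
    by-cases (no x≢0)   = ⁻¹-unique (trans (*-comm _ _) (*-inverseʳ x≢0))

  ^-⁻¹ : ∀ {x n} → x ^ suc n ≡ 1# → ∀ a → (x ^ a) ⁻¹ ≡ x ^ (n ℕ.* a)
  ^-⁻¹ {x} {n} x¹⁺ⁿ≡1 a = ⁻¹-unique (begin
    x ^ a * x ^ (n ℕ.* a)  ≡⟨ ^-+ x a (n ℕ.* a) ⟨
    x ^ (suc n ℕ.* a)      ≡⟨ ^-* x (suc n) a ⟩
    (x ^ suc n) ^ a        ≡⟨ cong (_^ a) x¹⁺ⁿ≡1 ⟩
    1# ^ a                 ≡⟨ 1^ a ⟩
    1#                     ∎)

  _HasOrder_ : Carrier → ℕ → Set
  x HasOrder n = x ^ n ≡ 1# × (∀ {d} → 0 < d → d < n → x ^ d ≢ 1#)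

  HasOrder⇒≢0 : ∀ {x n} .{{_ : NonZero n}} → x HasOrder n → x ≢ 0#
  HasOrder⇒≢0 {n = suc n} (xⁿ≡1 , _) refl = 0≢1 (trans (sym (zeroˡ _)) xⁿ≡1)

  ^-∸ : ∀ {x a b} → x ≢ 0# → a ≤ b → x ^ a ≡ x ^ b → x ^ (b ∸ a) ≡ 1#
  ^-∸ {x} {a} {b} x≢0 a≤b xᵃ≡xᵇ = *-cancelˡ (^-≢0 x≢0 a) (begin
    x ^ a * x ^ (b ∸ a)  ≡⟨ ^-+ x a (b ∸ a) ⟨
    x ^ (a ℕ.+ (b ∸ a))  ≡⟨ cong (x ^_) (ℕ.m+[n∸m]≡n a≤b) ⟩
    x ^ b                ≡⟨ xᵃ≡xᵇ ⟨
    x ^ a                ≡⟨ *-identityʳ _ ⟨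
    x ^ a * 1#           ∎)

  ^-injective-< : ∀ {x n} .{{_ : NonZero n}} → x HasOrder n →
                  ∀ {a b} → a ≤ b → b < n → x ^ a ≡ x ^ b → a ≡ b
  ^-injective-< {x} {n} x-order {a} {b} a≤b b<n xᵃ≡xᵇ with b ∸ a in b∸a≡
  ... | zero  = ℕ.≤-antisym a≤b (ℕ.m∸n≡0⇒m≤n b∸a≡)
  ... | suc _ = contradiction (subst (λ e → x ^ e ≡ 1#) b∸a≡ (^-∸ (HasOrder⇒≢0 x-order) a≤b xᵃ≡xᵇ))
                  (proj₂ x-order ℕ.z<s (subst (_< n) b∸a≡ (ℕ.≤-<-trans (ℕ.m∸n≤m b a) b<n)))

  ^-injective : ∀ {x n} .{{_ : NonZero n}} → x HasOrder n → ∀ {a b} → x ^ a ≡ x ^ b → a % n ≡ b % n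
  ^-injective {x} {n} x-order {a} {b} xᵃ≡xᵇ = by-cases (ℕ.≤-total (a % n) (b % n))
    where
    xᵃ′≡xᵇ′ : x ^ (a % n) ≡ x ^ (b % n)
    xᵃ′≡xᵇ′ = trans (sym (^-% (proj₁ x-order) a)) (trans xᵃ≡xᵇ (^-% (proj₁ x-order) b))
    by-cases : a % n ≤ b % n ⊎ b % n ≤ a % n → a % n ≡ b % n
    by-cases (inj₁ a′≤b′) = ^-injective-< x-order a′≤b′ (m%n<n b n) xᵃ′≡xᵇ′
    by-cases (inj₂ b′≤a′) = sym (^-injective-< x-order b′≤a′ (m%n<n a n) (sym xᵃ′≡xᵇ′))

  ^-HasOrder : ∀ {x} d {n} .{{_ : NonZero d}} → x HasOrder (d ℕ.* n) → (x ^ d) HasOrder n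
  ^-HasOrder {x} d {n} (xᵈⁿ≡1 , x-minimal) =
      trans (sym (^-* x d n)) xᵈⁿ≡1
    , λ {e} 0<e e<n xᵈᵉ≡1 →
        x-minimal (ℕ.*-mono-< (ℕ.>-nonZero⁻¹ d) 0<e) (ℕ.*-monoʳ-< d e<n) (trans (^-* x d e) xᵈᵉ≡1)

  coset≡true⇔ : ∀ y P x → coset y P x ≡ true ⇔ (∃[ h ] P h ≡ true × x ≡ y * h)
  coset≡true⇔ y P x = mk⇔
    (λ x∈yP → let i , _ , Pi∧x≡yi = Equivalence.to (any≡true⇔ _ (allFin q)) x∈yP
              in elt i , ∧-conicalˡ (P (elt i)) _ Pi∧x≡yi , ⌊⌋-witness (∧-conicalʳ (P (elt i)) _ Pi∧x≡yi))
    (λ (h , Ph , x≡yh) → Equivalence.from (any≡true⇔ _ (allFin q))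
      ( from h
      , ∈-allFin (from h)
      , subst (λ z → P z ∧ ⌊ x ≟ (y * z) ⌋ ≡ true) (sym (strictlyInverseˡ h))
              (trans (cong (_∧ _) Ph) (⌊⌋-yes (x ≟ (y * h)) x≡yh))))
    where open Inverse enum using (from; strictlyInverseˡ)

  IsSquare : Carrier → Set
  IsSquare x = ∃[ z ] z * z ≡ x

  IsSquare-* : ∀ {x y} → IsSquare x → IsSquare y → IsSquare (x * y)
  IsSquare-* (z , refl) (t , refl) =
    z * t , solve 2 (λ z t → (z :* t) :* (z :* t) := (z :* z) :* (t :* t)) refl z t

  IsSquare-cancel : ∀ {x y} → y ≢ 0# → IsSquare (x * (y * y)) → IsSquare x
  IsSquare-cancel {x} {y} y≢0 (z , z²≡xy²) = z * y ⁻¹ , (begin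
    (z * y ⁻¹) * (z * y ⁻¹)
      ≡⟨ solve 2 (λ z y′ → (z :* y′) :* (z :* y′) := (z :* z) :* (y′ :* y′)) refl z (y ⁻¹) ⟩
    (z * z) * (y ⁻¹ * y ⁻¹)
      ≡⟨ cong (_* (y ⁻¹ * y ⁻¹)) z²≡xy² ⟩
    (x * (y * y)) * (y ⁻¹ * y ⁻¹)
      ≡⟨ solve 3 (λ x y y′ → (x :* (y :* y)) :* (y′ :* y′) := x :* ((y :* y′) :* (y :* y′))) refl x y (y ⁻¹) ⟩
    x * ((y * y ⁻¹) * (y * y ⁻¹))
      ≡⟨ cong (λ e → x * (e * e)) (*-inverseʳ y≢0) ⟩
    x * (1# * 1#)
      ≡⟨ trans (cong (x *_) (*-identityˡ 1#)) (*-identityʳ x) ⟩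
    x ∎)

  ^-square⊎*square : ∀ x e → IsSquare (x ^ e) ⊎ ∃[ z ] x ^ e ≡ x * (z * z)
  ^-square⊎*square x zero    = inj₁ (1# , *-identityˡ 1#)
  ^-square⊎*square x (suc e) with ^-square⊎*square x e
  ... | inj₁ (z , z²≡xᵉ)   = inj₂ (z , cong (x *_) (sym z²≡xᵉ))
  ... | inj₂ (z , xᵉ≡xz²) =
    inj₁ (x * z , trans (solve 2 (λ x z → (x :* z) :* (x :* z) := x :* (x :* (z :* z))) refl x z)
                        (cong (x *_) (sym xᵉ≡xz²)))

module PrimitiveElement {N} (F : FiniteField (suc N)) (θ : FiniteField.Carrier F)
                        (θ-primitive : FiniteField.Primitive F θ) where

  open FiniteField F
  open FiniteFieldProperties F
  open Enumeration enum using (elt-injective)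
  open Inverse enum using (from; strictlyInverseˡ)
  open ≡-Reasoning

  θ≢0 : θ ≢ 0#
  θ≢0 = proj₁ θ-primitive

  log : ∀ x → x ≢ 0# → ℕ
  log x x≢0 = proj₁ (proj₂ θ-primitive x x≢0)

  θ^log : ∀ x x≢0 → θ ^ log x x≢0 ≡ x
  θ^log x x≢0 = proj₂ (proj₂ θ-primitive x x≢0)

  private
    from0≢from : ∀ {x} → x ≢ 0# → from 0# ≢ from x
    from0≢from {x} x≢0 eq =
      x≢0 (trans (sym (strictlyInverseˡ x)) (trans (cong elt (sym eq)) (strictlyInverseˡ 0#)))

    from0≢from-θ^ : ∀ k → from 0# ≢ from (θ ^ k)
    from0≢from-θ^ k = from0≢from (^-≢0 θ≢0 k)

    nonzero : Fin N → Carrier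
    nonzero i = elt (punchIn (from 0#) i)

    nonzero≢0 : ∀ i → nonzero i ≢ 0#
    nonzero≢0 i eq = Fin.punchInᵢ≢i (from 0#) i (elt-injective (trans eq (sym (strictlyInverseˡ 0#))))

  -- Pigeonhole: θ ^ 0, …, θ ^ N are N + 1 values among the N non-zero elements.
  θ-period≤N : ∃[ d ] 0 < d × d ≤ N × θ ^ d ≡ 1#
  θ-period≤N with Fin.pigeonhole (ℕ.n<1+n N) (λ k → punchOut (from0≢from-θ^ (toℕ k)))
  ... | i , j , i<j , same-index =
      toℕ j ∸ toℕ i
    , ℕ.m<n⇒0<n∸m i<j
    , ℕ.≤-trans (ℕ.m∸n≤m (toℕ j) (toℕ i)) (ℕ.<⇒≤pred (Fin.toℕ<n j))
    , ^-∸ θ≢0 (ℕ.<⇒≤ i<j) θⁱ≡θʲ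
    where
    θⁱ≡θʲ : θ ^ toℕ i ≡ θ ^ toℕ j
    θⁱ≡θʲ = trans (sym (strictlyInverseˡ _))
              (trans (cong elt (Fin.punchOut-injective (from0≢from-θ^ (toℕ i)) (from0≢from-θ^ (toℕ j)) same-index))
                     (strictlyInverseˡ _))

  N≤θ-period : ∀ {d} → 0 < d → θ ^ d ≡ 1# → N ≤ d
  N≤θ-period {d} 0<d θᵈ≡1 = Fin.injective⇒≤ {f = log-mod-d} log-mod-d-injective
    where
    instance _ = ℕ.>-nonZero 0<d
    log-mod-d : Fin N → Fin d
    log-mod-d i = fromℕ< (m%n<n (log (nonzero i) (nonzero≢0 i)) d)
    log-mod-d-injective : ∀ {i j} → log-mod-d i ≡ log-mod-d j → i ≡ j
    log-mod-d-injective {i} {j} eq = Fin.punchIn-injective (from 0#) i j (elt-injective (begin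
      nonzero i                                ≡⟨ θ^log _ _ ⟨
      θ ^ log (nonzero i) _                    ≡⟨ ^-% θᵈ≡1 _ ⟩
      θ ^ (log (nonzero i) (nonzero≢0 i) % d)  ≡⟨ cong (θ ^_) (Fin.fromℕ<-injective _ _ _ _ eq) ⟩
      θ ^ (log (nonzero j) (nonzero≢0 j) % d)  ≡⟨ ^-% θᵈ≡1 _ ⟨
      θ ^ log (nonzero j) _                    ≡⟨ θ^log _ _ ⟩
      nonzero j                                ∎))

  θ-HasOrder : θ HasOrder N
  θ-HasOrder with θ-period≤N
  ... | d , 0<d , d≤N , θᵈ≡1 =
      subst (λ e → θ ^ e ≡ 1#) (ℕ.≤-antisym d≤N (N≤θ-period 0<d θᵈ≡1)) θᵈ≡1
    , λ 0<e e<N θᵉ≡1 → ℕ.<⇒≱ e<N (N≤θ-period 0<e θᵉ≡1)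

  instance
    N≢0 : NonZero N
    N≢0 = ℕ.>-nonZero (let _ , 0<d , d≤N , _ = θ-period≤N in ℕ.<-≤-trans 0<d d≤N)

  ^N≡1 : ∀ {x} → x ≢ 0# → x ^ N ≡ 1#
  ^N≡1 {x} x≢0 = begin
    x ^ N          ≡⟨ cong (_^ N) (θ^log x x≢0) ⟨
    (θ ^ e) ^ N    ≡⟨ ^-* θ e N ⟨
    θ ^ (e ℕ.* N)  ≡⟨ cong (θ ^_) (ℕ.*-comm e N) ⟩
    θ ^ (N ℕ.* e)  ≡⟨ ^-* θ N e ⟩
    (θ ^ N) ^ e    ≡⟨ cong (_^ e) (proj₁ θ-HasOrder) ⟩
    1# ^ e         ≡⟨ 1^ e ⟩
    1#             ∎
    where e = log x x≢0

  -- ⟨ g ⟩ only tries the exponents below q; they suffice because g ^ N ≡ 1#.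
  ⟨⟩≡true⇔ : ∀ {g} → g ≢ 0# → ∀ x → ⟨ g ⟩ x ≡ true ⇔ (∃[ k ] x ≡ g ^ k)
  ⟨⟩≡true⇔ {g} g≢0 x = mk⇔
    (λ x∈⟨g⟩ → let k , _ , x≟gᵏ = Equivalence.to (any≡true⇔ _ (upTo (suc N))) x∈⟨g⟩
              in k , ⌊⌋-witness x≟gᵏ)
    (λ (k , x≡gᵏ) → Equivalence.from (any≡true⇔ _ (upTo (suc N)))
      ( k % N
      , ∈-upTo⁺ (ℕ.m<n⇒m<1+n (m%n<n k N))
      , ⌊⌋-yes (x ≟ (g ^ (k % N))) (trans x≡gᵏ (^-% (^N≡1 g≢0) k))))

  non-square⇒θ*square : ∀ {x} → x ≢ 0# → ¬ IsSquare x → ∃[ z ] x ≡ θ * (z * z)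
  non-square⇒θ*square {x} x≢0 x-non-square with ^-square⊎*square θ (log x x≢0)
  ... | inj₁ θᵉ-square    = contradiction (subst IsSquare (θ^log x x≢0) θᵉ-square) x-non-square
  ... | inj₂ (z , θᵉ≡θz²) = z , trans (sym (θ^log x x≢0)) θᵉ≡θz²

  non-square*non-square : ∀ {x y} → x ≢ 0# → y ≢ 0# → ¬ IsSquare x → ¬ IsSquare y → IsSquare (x * y)
  non-square*non-square x≢0 y≢0 x-non-square y-non-square
    with non-square⇒θ*square x≢0 x-non-square | non-square⇒θ*square y≢0 y-non-square
  ... | z , refl | t , refl = θ * (z * t) ,
    solve 3 (λ θ z t → (θ :* (z :* t)) :* (θ :* (z :* t)) := (θ :* (z :* z)) :* (θ :* (t :* t))) refl θ z t

module CyclotomicFamily (m l : ℕ) .{{_ : NonZero m}} .{{_ : NonZero l}}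
                        (F : FiniteField (suc (m ℕ.* (l ℕ.* l)))) (θ : FiniteField.Carrier F)
                        (θ-primitive : FiniteField.Primitive F θ) where

  open FiniteField F
  open FiniteFieldProperties F
  open PrimitiveElement F θ θ-primitive
  open Enumeration enum using (∑-involution; ∑-image)
  open ≡-Reasoning

  N K : ℕ
  N = m ℕ.* (l ℕ.* l)
  K = m ℕ.* l

  instance
    K≢0 : NonZero K
    K≢0 = ℕ.m*n≢0 m l

  β γ : Carrier
  β = θ ^ l
  γ = β ^ m

  A : Fin m → Carrier → Bool
  A = Afam m l θ

  H : Carrier → Bool
  H = ⟨ β ⟩

  β≢0 : β ≢ 0#
  β≢0 = ^-≢0 θ≢0 l

  γ≢0 : γ ≢ 0#
  γ≢0 = ^-≢0 β≢0 m

  β-HasOrder : β HasOrder K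
  β-HasOrder = ^-HasOrder l (subst (θ HasOrder_) (N≡l*K m l) θ-HasOrder)
    where
    N≡l*K : ∀ m l → m ℕ.* (l ℕ.* l) ≡ l ℕ.* (m ℕ.* l)
    N≡l*K = solve-∀

  γ-HasOrder : γ HasOrder l
  γ-HasOrder = ^-HasOrder m β-HasOrder

  InA : ℕ → Carrier → Set
  InA j x = ∃[ k ] x ≡ β ^ j * γ ^ k

  InH : Carrier → Set
  InH x = ∃[ k ] x ≡ β ^ k

  A⇔InA : ∀ j x → A j x ≡ true ⇔ InA (toℕ j) x
  A⇔InA j x = mk⇔
    (λ x∈A → let y , y∈C , x≡βʲy = Equivalence.to (coset≡true⇔ (β ^ toℕ j) ⟨ γ ⟩ x) x∈A
                 k , y≡γᵏ        = Equivalence.to (⟨⟩≡true⇔ γ≢0 y) y∈C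
             in k , trans x≡βʲy (cong (β ^ toℕ j *_) y≡γᵏ))
    (λ (k , x≡βʲγᵏ) → Equivalence.from (coset≡true⇔ (β ^ toℕ j) ⟨ γ ⟩ x)
      (γ ^ k , Equivalence.from (⟨⟩≡true⇔ γ≢0 (γ ^ k)) (k , refl) , x≡βʲγᵏ))

  H⇔InH : ∀ x → H x ≡ true ⇔ InH x
  H⇔InH = ⟨⟩≡true⇔ β≢0

  β^*γ^ : ∀ j k → β ^ j * γ ^ k ≡ β ^ (j ℕ.+ m ℕ.* k)
  β^*γ^ j k = trans (cong (β ^ j *_) (sym (^-* β m k))) (sym (^-+ β j (m ℕ.* k)))

  β^-split : ∀ n → β ^ n ≡ β ^ (n % m) * γ ^ (n / m)
  β^-split n = trans (cong (β ^_) (trans (m≡m%n+[m/n]*n n m) (cong (n % m ℕ.+_) (ℕ.*-comm (n / m) m))))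
                     (sym (β^*γ^ (n % m) (n / m)))

  InA⇒≢0 : ∀ j {x} → InA j x → x ≢ 0#
  InA⇒≢0 j (k , refl) = *-≢0 (^-≢0 β≢0 j) (^-≢0 γ≢0 k)

  InA-unique : ∀ {i j x} → i < m → j < m → InA i x → InA j x → i ≡ j
  InA-unique {i} {j} i<m j<m (k , x≡βⁱγᵏ) (k′ , x≡βʲγᵏ′) =
    low-digit-unique (m∣m*n l) i<m j<m (^-injective β-HasOrder (begin
      β ^ (i ℕ.+ m ℕ.* k)   ≡⟨ β^*γ^ i k ⟨
      β ^ i * γ ^ k         ≡⟨ trans (sym x≡βⁱγᵏ) x≡βʲγᵏ′ ⟩
      β ^ j * γ ^ k′        ≡⟨ β^*γ^ j k′ ⟩
      β ^ (j ℕ.+ m ℕ.* k′)  ∎))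

  InA⇒InH : ∀ j {x} → InA j x → InH x
  InA⇒InH j (k , x≡βʲγᵏ) = j ℕ.+ m ℕ.* k , trans x≡βʲγᵏ (β^*γ^ j k)

  InH⇒InA : ∀ {x} → InH x → ∃[ j ] j < m × InA j x
  InH⇒InA (n , x≡βⁿ) = n % m , m%n<n n m , n / m , trans x≡βⁿ (β^-split n)

  InH⇒A : ∀ {x} → InH x → ∃[ i ] A i x ≡ true
  InH⇒A {x} x∈H with InH⇒InA x∈H
  ... | j , j<m , x∈Aⱼ = fromℕ< j<m , Equivalence.from (A⇔InA (fromℕ< j<m) x)
                                        (subst (λ e → InA e x) (sym (Fin.toℕ-fromℕ< j<m)) x∈Aⱼ)

  InH-* : ∀ {x y} → InH x → InH y → InH (x * y)
  InH-* (a , refl) (b , refl) = a ℕ.+ b , sym (^-+ β a b)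

  InH-⁻¹ : ∀ {x} → InH x → InH (x ⁻¹)
  InH-⁻¹ (a , refl) = ℕ.pred K ℕ.* a , ^-⁻¹ {β} {ℕ.pred K} β^[1+pred-K]≡1 a
    where
    β^[1+pred-K]≡1 : β ^ suc (ℕ.pred K) ≡ 1#
    β^[1+pred-K]≡1 = subst (λ e → β ^ e ≡ 1#) (sym (ℕ.suc-pred K)) (proj₁ β-HasOrder)

  InA-* : ∀ i j {x y} → InA i x → InA j y → InA ((i ℕ.+ j) % m) (x * y)
  InA-* i j (k , refl) (k′ , refl) = (i ℕ.+ j) / m ℕ.+ (k ℕ.+ k′) , (begin
    β ^ i * γ ^ k * (β ^ j * γ ^ k′)
      ≡⟨ solve 4 (λ a b c d → a :* b :* (c :* d) := (a :* c) :* (b :* d)) refl _ _ _ _ ⟩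
    β ^ i * β ^ j * (γ ^ k * γ ^ k′)
      ≡⟨ cong₂ _*_ (sym (^-+ β i j)) (sym (^-+ γ k k′)) ⟩
    β ^ (i ℕ.+ j) * γ ^ (k ℕ.+ k′)
      ≡⟨ cong (_* γ ^ (k ℕ.+ k′)) (β^-split (i ℕ.+ j)) ⟩
    β ^ ((i ℕ.+ j) % m) * γ ^ ((i ℕ.+ j) / m) * γ ^ (k ℕ.+ k′)
      ≡⟨ trans (*-assoc _ _ _) (cong (β ^ ((i ℕ.+ j) % m) *_) (sym (^-+ γ ((i ℕ.+ j) / m) (k ℕ.+ k′)))) ⟩
    β ^ ((i ℕ.+ j) % m) * γ ^ ((i ℕ.+ j) / m ℕ.+ (k ℕ.+ k′)) ∎)

  InA-*-unshift : ∀ i j {b z} → InA j (z * b ⁻¹) → InA i b → InA ((i ℕ.+ j) % m) z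
  InA-*-unshift i j {b} {z} zb⁻¹∈Aⱼ b∈Aᵢ =
    subst₂ InA (cong (_% m) (ℕ.+-comm j i)) zb⁻¹b≡z (InA-* j i zb⁻¹∈Aⱼ b∈Aᵢ)
    where
    zb⁻¹b≡z : z * b ⁻¹ * b ≡ z
    zb⁻¹b≡z = trans (*-assoc _ _ _)
                (trans (cong (z *_) (trans (*-comm _ _) (*-inverseʳ (InA⇒≢0 i b∈Aᵢ)))) (*-identityʳ z))

  -- z * b ⁻¹ lies in H, hence in some A_j; then z ∈ A_(i+j), and disjointness forces j = c.
  InA-unshift : ∀ {i c b z} → c < m → InA i b → InA ((i ℕ.+ c) % m) z → InA c (z * b ⁻¹)
  InA-unshift {i} {c} {b} {z} c<m b∈Aᵢ z∈Aᵢ₊c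
    with InH⇒InA (InH-* (InA⇒InH ((i ℕ.+ c) % m) z∈Aᵢ₊c) (InH-⁻¹ (InA⇒InH i b∈Aᵢ)))
  ... | j , j<m , zb⁻¹∈Aⱼ = subst (λ e → InA e (z * b ⁻¹)) j≡c zb⁻¹∈Aⱼ
    where
    i+j≡i+c : (i ℕ.+ j) % m ≡ (i ℕ.+ c) % m
    i+j≡i+c = InA-unique (m%n<n _ m) (m%n<n _ m) (InA-*-unshift i j zb⁻¹∈Aⱼ b∈Aᵢ) z∈Aᵢ₊c
    j≡c : j ≡ c
    j≡c = trans (sym (m<n⇒m%n≡m j<m)) (trans (%-cancelˡ-+ m i j c i+j≡i+c) (m<n⇒m%n≡m c<m))

  A-shift⇔ : ∀ {i c b z} → A i b ≡ true → A (shift m (toℕ c) i) z ≡ true ⇔ A c (z * b ⁻¹) ≡ true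
  A-shift⇔ {i} {c} {b} {z} b∈Aᵢ = mk⇔
    (λ z∈Aᵢ₊c → Equivalence.from (A⇔InA c (z * b ⁻¹)) (InA-unshift (Fin.toℕ<n c) b∈A
                  (subst (λ e → InA e z) toℕ-i⊕c (Equivalence.to (A⇔InA i⊕c z) z∈Aᵢ₊c))))
    (λ zb⁻¹∈Ac → Equivalence.from (A⇔InA i⊕c z) (subst (λ e → InA e z) (sym toℕ-i⊕c)
                  (InA-*-unshift (toℕ i) (toℕ c) (Equivalence.to (A⇔InA c (z * b ⁻¹)) zb⁻¹∈Ac) b∈A)))
    where
    i⊕c : Fin m
    i⊕c = shift m (toℕ c) i
    toℕ-i⊕c : toℕ i⊕c ≡ (toℕ i ℕ.+ toℕ c) % m
    toℕ-i⊕c = toℕ-shift m (toℕ c) i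
    b∈A : InA (toℕ i) b
    b∈A = Equivalence.to (A⇔InA i b) b∈Aᵢ

  A-disjoint : ∀ i j x → i ≢ j → A i x ≡ true → A j x ≡ false
  A-disjoint i j x i≢j x∈Aᵢ = ¬-not λ x∈Aⱼ → i≢j (Fin.toℕ-injective (InA-unique (Fin.toℕ<n i) (Fin.toℕ<n j)
    (Equivalence.to (A⇔InA i x) x∈Aᵢ) (Equivalence.to (A⇔InA j x) x∈Aⱼ)))

  A-size : ∀ j → count (λ k → A j (elt k)) ≡ l
  A-size j = begin
    count (λ k → A j (elt k))
      ≡⟨ sumFin≡∑ (𝟙 ∘ A j ∘ elt) ⟩
    ∑[ k < suc N ] 𝟙 (A j (elt k))
      ≡⟨ sum-cong-≗ (λ k → cong 𝟙 (∧-identityʳ (A j (elt k)))) ⟨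
    ∑[ k < suc N ] 𝟙 (A j (elt k) ∧ true)
      ≡⟨ ∑-image _≟_ βʲγ^ βʲγ^-injective (A j) (λ _ → true) image ⟩
    ∑[ t < l ] 1
      ≡⟨ ∑-1 l ⟩
    l ∎
    where
    βʲγ^ : Fin l → Carrier
    βʲγ^ t = β ^ toℕ j * γ ^ toℕ t
    βʲγ^-injective : ∀ {t t′} → βʲγ^ t ≡ βʲγ^ t′ → t ≡ t′
    βʲγ^-injective {t} {t′} eq = Fin.toℕ-injective (begin
      toℕ t       ≡⟨ m<n⇒m%n≡m (Fin.toℕ<n t) ⟨
      toℕ t % l   ≡⟨ ^-injective γ-HasOrder (*-cancelˡ (^-≢0 β≢0 (toℕ j)) eq) ⟩
      toℕ t′ % l  ≡⟨ m<n⇒m%n≡m (Fin.toℕ<n t′) ⟩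
      toℕ t′      ∎)
    image : ∀ x → A j x ≡ true ⇔ (∃[ t ] βʲγ^ t ≡ x)
    image x = mk⇔
      (λ x∈A → let k , x≡βʲγᵏ = Equivalence.to (A⇔InA j x) x∈A in
        fromℕ< (m%n<n k l) , sym (trans x≡βʲγᵏ (cong (β ^ toℕ j *_)
          (trans (^-% (proj₁ γ-HasOrder) k) (cong (γ ^_) (sym (Fin.toℕ-fromℕ< (m%n<n k l))))))))
      (λ (t , βʲγᵗ≡x) → Equivalence.from (A⇔InA j x) (toℕ t , sym βʲγᵗ≡x))

  1∈A₀ : InA 0 1#
  1∈A₀ = 0 , sym (*-identityˡ 1#)

  R-nonzero : ∀ {c} → 1 ≤ toℕ c → ∀ x → A c (x + 1#) ≡ true → x ≢ 0#
  R-nonzero {c} 1≤c x x+1∈A refl =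
    ℕ.<⇒≢ 1≤c (sym (InA-unique (Fin.toℕ<n c) (ℕ.>-nonZero⁻¹ m) 1∈Ac 1∈A₀))
    where
    1∈Ac : InA (toℕ c) 1#
    1∈Ac = subst (InA (toℕ c)) (+-identityˡ 1#) (Equivalence.to (A⇔InA c (0# + 1#)) x+1∈A)

  module _ (c : Fin m) {g} (g≢0 : g ≢ 0#) where

    σ : Carrier → Carrier
    σ b = g * b ⁻¹

    σ0≡0 : σ 0# ≡ 0#
    σ0≡0 = trans (cong (g *_) 0⁻¹) (zeroʳ g)

    σ-involutive : ∀ b → σ (σ b) ≡ b
    σ-involutive b = by-cases (b ≟ 0#)
      where
      by-cases : Dec (b ≡ 0#) → σ (σ b) ≡ b
      by-cases (yes refl) = trans (cong σ σ0≡0) σ0≡0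
      by-cases (no b≢0) = begin
        g * (g * b ⁻¹) ⁻¹  ≡⟨ cong (g *_) (⁻¹-unique gb⁻¹·g⁻¹b≡1) ⟩
        g * (g ⁻¹ * b)     ≡⟨ trans (sym (*-assoc _ _ _)) (cong (_* b) (*-inverseʳ g≢0)) ⟩
        1# * b             ≡⟨ *-identityˡ b ⟩
        b                  ∎
        where
        gb⁻¹·g⁻¹b≡1 : g * b ⁻¹ * (g ⁻¹ * b) ≡ 1#
        gb⁻¹·g⁻¹b≡1 = begin
          g * b ⁻¹ * (g ⁻¹ * b)
            ≡⟨ solve 4 (λ g b′ g′ b → g :* b′ :* (g′ :* b) := (g :* g′) :* (b :* b′)) refl _ _ _ _ ⟩
          g * g ⁻¹ * (b * b ⁻¹)
            ≡⟨ cong₂ _*_ (*-inverseʳ g≢0) (*-inverseʳ b≢0) ⟩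
          1# * 1#
            ≡⟨ *-identityˡ 1# ⟩
          1# ∎

    σ∈gH⇔InH : ∀ b → coset g H (σ b) ≡ true ⇔ InH b
    σ∈gH⇔InH b = mk⇔
      (λ σb∈gH → let h , h∈H , gb⁻¹≡gh = Equivalence.to (coset≡true⇔ g H (σ b)) σb∈gH in
        subst InH (trans (cong _⁻¹ (sym (*-cancelˡ g≢0 gb⁻¹≡gh))) (⁻¹-involutive b))
                  (InH-⁻¹ (Equivalence.to (H⇔InH h) h∈H)))
      (λ b∈H → Equivalence.from (coset≡true⇔ g H (σ b))
        (b ⁻¹ , Equivalence.from (H⇔InH (b ⁻¹)) (InH-⁻¹ b∈H) , refl))

    A-shift≡ : ∀ {i b} → A i b ≡ true → A (shift m (toℕ c) i) (g + b) ≡ A c (σ b + 1#)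
    A-shift≡ {i} {b} b∈Aᵢ =
      ⇔→≡ (subst (λ w → A (shift m (toℕ c) i) (g + b) ≡ true ⇔ A c w ≡ true) g+b/b≡σb+1 (A-shift⇔ b∈Aᵢ))
      where
      b≢0 : b ≢ 0#
      b≢0 = InA⇒≢0 (toℕ i) (Equivalence.to (A⇔InA i b) b∈Aᵢ)
      g+b/b≡σb+1 : (g + b) * b ⁻¹ ≡ σ b + 1#
      g+b/b≡σb+1 = trans (distribʳ _ g b) (cong (σ b +_) (*-inverseʳ b≢0))

    ∑-shifted≡ : ∀ b → ∑[ i < m ] 𝟙 (A (shift m (toℕ c) i) (g + b) ∧ A i b)
                        ≡ 𝟙 (A c (σ b + 1#) ∧ coset g H (σ b))
    ∑-shifted≡ b with Fin.any? (λ i → A i b Bool.≟ true)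
    ... | yes (i₀ , b∈Aᵢ₀) = begin
      ∑[ i < m ] 𝟙 (A (shift m (toℕ c) i) (g + b) ∧ A i b)
        ≡⟨ ∑-δ i₀ (λ i i≢i₀ → 𝟙-∧-falseʳ _ (A-disjoint i₀ i b (i≢i₀ ∘ sym) b∈Aᵢ₀)) ⟩
      𝟙 (A (shift m (toℕ c) i₀) (g + b) ∧ A i₀ b)
        ≡⟨ cong₂ (λ s t → 𝟙 (s ∧ t)) (A-shift≡ b∈Aᵢ₀) (trans b∈Aᵢ₀ (sym σb∈gH)) ⟩
      𝟙 (A c (σ b + 1#) ∧ coset g H (σ b)) ∎
      where
      σb∈gH : coset g H (σ b) ≡ true
      σb∈gH = Equivalence.from (σ∈gH⇔InH b) (InA⇒InH (toℕ i₀) (Equivalence.to (A⇔InA i₀ b) b∈Aᵢ₀))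
    ... | no b∉⋃A = begin
      ∑[ i < m ] 𝟙 (A (shift m (toℕ c) i) (g + b) ∧ A i b)
        ≡⟨ ∑-zero (λ i → 𝟙-∧-falseʳ _ (¬-not (b∉⋃A ∘ (i ,_)))) ⟩
      0
        ≡⟨ 𝟙-∧-falseʳ _ (¬-not σb∉gH) ⟨
      𝟙 (A c (σ b + 1#) ∧ coset g H (σ b)) ∎
      where
      σb∉gH : coset g H (σ b) ≢ true
      σb∉gH = b∉⋃A ∘ InH⇒A ∘ Equivalence.to (σ∈gH⇔InH b)

    cOcc≡count : cOcc additiveGroup m (toℕ c) A g ≡ count (λ i → A c (elt i + 1#) ∧ coset g H (elt i))
    cOcc≡count = begin
      cOcc additiveGroup m (toℕ c) A g
        ≡⟨ cOcc≡∑∑ additiveGroup m (toℕ c) A g ⟩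
      ∑[ b < suc N ] ∑[ i < m ] 𝟙 (A (shift m (toℕ c) i) (g + elt b) ∧ A i (elt b))
        ≡⟨ sum-cong-≗ (∑-shifted≡ ∘ elt) ⟩
      ∑[ b < suc N ] 𝟙 (A c (σ (elt b) + 1#) ∧ coset g H (σ (elt b)))
        ≡⟨ ∑-involution σ σ-involutive (λ x → 𝟙 (A c (x + 1#) ∧ coset g H x)) ⟩
      ∑[ x < suc N ] 𝟙 (A c (elt x + 1#) ∧ coset g H (elt x))
        ≡⟨ sumFin≡∑ (λ x → 𝟙 (A c (elt x + 1#) ∧ coset g H (elt x))) ⟨
      count (λ x → A c (elt x + 1#) ∧ coset g H (elt x)) ∎

  IsCCEDF⇔CompleteCosetReps : ∀ c → 1 ≤ toℕ c →
    IsCCEDF additiveGroup m l 1 (toℕ c) A ⇔ CompleteCosetReps H (λ x → A c (x + 1#))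
  IsCCEDF⇔CompleteCosetReps c 1≤c = mk⇔
    (λ (_ , _ , occurrences) →
      R-nonzero 1≤c , λ y y≢0 → trans (sym (cOcc≡count c y≢0)) (occurrences y y≢0))
    (λ (_ , representatives) →
      A-disjoint , A-size , λ g g≢0 → trans (cOcc≡count c g≢0) (representatives g g≢0))

module QuadraticCase (m : ℕ) .{{_ : NonZero m}}
                     (F : FiniteField (suc (m ℕ.* (2 ℕ.* 2)))) (θ : FiniteField.Carrier F)
                     (θ-primitive : FiniteField.Primitive F θ) where

  open FiniteField F
  open FiniteFieldProperties F
  open PrimitiveElement F θ θ-primitive
  open CyclotomicFamily m 2 F θ θ-primitive
  open Enumeration enum using (∑-image)
  open import Algebra.Properties.Group +-group using (x≈z//y; //-rightDividesˡ; inverseʳ-unique; ∙-cancelʳ)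
  open ≡-Reasoning

  γ*γ≡1 : γ * γ ≡ 1#
  γ*γ≡1 = trans (cong (γ *_) (sym (*-identityʳ γ))) (proj₁ γ-HasOrder)

  γ≢1 : γ ≢ 1#
  γ≢1 γ≡1 = proj₂ γ-HasOrder ℕ.z<s (ℕ.s<s ℕ.z<s) (trans (*-identityʳ γ) γ≡1)

  1+γ≡0 : 1# + γ ≡ 0#
  1+γ≡0 with (1# + γ) ≟ 0#
  ... | yes 1+γ≡0 = 1+γ≡0
  ... | no 1+γ≢0  = contradiction (*-cancelˡ 1+γ≢0 (begin
    (1# + γ) * γ    ≡⟨ distribʳ γ 1# γ ⟩
    1# * γ + γ * γ  ≡⟨ cong₂ _+_ (*-identityˡ γ) γ*γ≡1 ⟩
    γ + 1#          ≡⟨ +-comm γ 1# ⟩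
    1# + γ          ≡⟨ *-identityʳ _ ⟨
    (1# + γ) * 1#   ∎)) γ≢1

  γ≡-1 : γ ≡ - 1#
  γ≡-1 = inverseʳ-unique 1# γ 1+γ≡0

  γ^≡1⊎γ^≡γ : ∀ k → γ ^ k ≡ 1# ⊎ γ ^ k ≡ γ
  γ^≡1⊎γ^≡γ zero    = inj₁ refl
  γ^≡1⊎γ^≡γ (suc k) with γ^≡1⊎γ^≡γ k
  ... | inj₁ γᵏ≡1 = inj₂ (trans (cong (γ *_) γᵏ≡1) (*-identityʳ γ))
  ... | inj₂ γᵏ≡γ = inj₁ (trans (cong (γ *_) γᵏ≡γ) γ*γ≡1)

  β^≡θ^*θ^ : ∀ k → β ^ k ≡ θ ^ k * θ ^ k
  β^≡θ^*θ^ k = trans (sym (^-* θ 2 k)) (trans (cong (θ ^_ ∘ (k ℕ.+_)) (ℕ.+-identityʳ k)) (^-+ θ k k))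

  -- y * y ∈ H, so x ∈ yH iff x * y ∈ H, and H consists of the non-zero squares.
  coset⇔IsSquare : ∀ {x y} → x ≢ 0# → y ≢ 0# → coset y H x ≡ true ⇔ IsSquare (x * y)
  coset⇔IsSquare {x} {y} x≢0 y≢0 = mk⇔ to from
    where
    to : coset y H x ≡ true → IsSquare (x * y)
    to x∈yH with Equivalence.to (coset≡true⇔ y H x) x∈yH
    ... | h , h∈H , refl with Equivalence.to (H⇔InH h) h∈H
    ... | k , refl = y * θ ^ k , (begin
      y * θ ^ k * (y * θ ^ k)  ≡⟨ solve 2 (λ y t → y :* t :* (y :* t) := y :* (t :* t) :* y) refl y (θ ^ k) ⟩
      y * (θ ^ k * θ ^ k) * y  ≡⟨ cong (λ h → y * h * y) (β^≡θ^*θ^ k) ⟨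
      y * β ^ k * y            ∎)
    from : IsSquare (x * y) → coset y H x ≡ true
    from (z , z²≡xy) =
      Equivalence.from (coset≡true⇔ y H x) (β ^ f , Equivalence.from (H⇔InH (β ^ f)) (f , refl) , sym (begin
        y * β ^ f
          ≡⟨ cong (y *_) (trans (β^≡θ^*θ^ f) (cong₂ _*_ θᶠ≡zy⁻¹ θᶠ≡zy⁻¹)) ⟩
        y * ((z * y ⁻¹) * (z * y ⁻¹))
          ≡⟨ solve 3 (λ y z y′ → y :* ((z :* y′) :* (z :* y′)) := z :* z :* y′ :* (y :* y′)) refl y z (y ⁻¹) ⟩
        z * z * y ⁻¹ * (y * y ⁻¹)
          ≡⟨ cong₂ (λ a b → a * y ⁻¹ * b) z²≡xy (*-inverseʳ y≢0) ⟩
        x * y * y ⁻¹ * 1#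
          ≡⟨ trans (*-identityʳ _) (*-assoc x y (y ⁻¹)) ⟩
        x * (y * y ⁻¹)
          ≡⟨ trans (cong (x *_) (*-inverseʳ y≢0)) (*-identityʳ x) ⟩
        x ∎))
      where
      z≢0 : z ≢ 0#
      z≢0 refl = *-≢0 x≢0 y≢0 (trans (sym z²≡xy) (zeroˡ 0#))
      y⁻¹≢0 : y ⁻¹ ≢ 0#
      y⁻¹≢0 y⁻¹≡0 = 0≢1 (trans (sym (zeroʳ y)) (trans (cong (y *_) (sym y⁻¹≡0)) (*-inverseʳ y≢0)))
      f = log (z * y ⁻¹) (*-≢0 z≢0 y⁻¹≢0)
      θᶠ≡zy⁻¹ = θ^log (z * y ⁻¹) (*-≢0 z≢0 y⁻¹≢0)

  module _ (c : Fin m) (1≤c : 1 ≤ toℕ c) where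

    u : Carrier
    u = β ^ toℕ c

    R : Carrier → Bool
    R x = A c (x + 1#)

    r : Fin 2 → Carrier
    r 0F = u - 1#
    r 1F = (u * γ) - 1#

    R⇔r : ∀ x → R x ≡ true ⇔ (∃[ t ] r t ≡ x)
    R⇔r x = mk⇔ to from
      where
      to : R x ≡ true → ∃[ t ] r t ≡ x
      to x+1∈A with Equivalence.to (A⇔InA c (x + 1#)) x+1∈A
      ... | k , x+1≡uγᵏ with γ^≡1⊎γ^≡γ k
      ... | inj₁ γᵏ≡1 = 0F , sym (x≈z//y x 1# u (trans x+1≡uγᵏ (trans (cong (u *_) γᵏ≡1) (*-identityʳ u))))
      ... | inj₂ γᵏ≡γ = 1F , sym (x≈z//y x 1# (u * γ) (trans x+1≡uγᵏ (cong (u *_) γᵏ≡γ)))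
      from : ∃[ t ] r t ≡ x → R x ≡ true
      from (0F , refl) = Equivalence.from (A⇔InA c (r 0F + 1#))
        (0 , trans (//-rightDividesˡ 1# u) (sym (*-identityʳ u)))
      from (1F , refl) = Equivalence.from (A⇔InA c (r 1F + 1#))
        (1 , trans (//-rightDividesˡ 1# (u * γ)) (cong (u *_) (sym (*-identityʳ γ))))

    u≢u*γ : u ≢ u * γ
    u≢u*γ u≡uγ = γ≢1 (sym (*-cancelˡ (^-≢0 β≢0 (toℕ c)) (trans (*-identityʳ u) u≡uγ)))

    r-injective : ∀ {t t′} → r t ≡ r t′ → t ≡ t′
    r-injective {0F} {0F} _  = refl
    r-injective {0F} {1F} eq = contradiction (∙-cancelʳ _ _ _ eq) u≢u*γ
    r-injective {1F} {0F} eq = contradiction (sym (∙-cancelʳ _ _ _ eq)) u≢u*γ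
    r-injective {1F} {1F} _  = refl

    r≢0 : ∀ t → r t ≢ 0#
    r≢0 t = R-nonzero 1≤c (r t) (Equivalence.from (R⇔r (r t)) (t , refl))

    count-R∧coset : ∀ y → count (λ i → R (elt i) ∧ coset y H (elt i))
                           ≡ 𝟙 (coset y H (r 0F)) ℕ.+ (𝟙 (coset y H (r 1F)) ℕ.+ 0)
    count-R∧coset y =
      trans (sumFin≡∑ (λ i → 𝟙 (R (elt i) ∧ coset y H (elt i)))) (∑-image _≟_ r r-injective R (coset y H) R⇔r)

    s : Carrier
    s = (θ ^ (4 ℕ.* toℕ c)) - 1#

    -- γ = -1, so r 0F = u + γ, r 1F = (u + 1) γ and s = u² + γ; the identity is then polynomial.
    s≡r₀r₁*θᵐ*θᵐ : s ≡ (r 0F * r 1F) * (θ ^ m * θ ^ m)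
    s≡r₀r₁*θᵐ*θᵐ = begin
      (θ ^ (4 ℕ.* toℕ c)) - 1#
        ≡⟨ cong₂ _+_ θ⁴ᶜ≡u*u (sym γ≡-1) ⟩
      u * u + γ
        ≡⟨ trans (*-identityˡ _) (+-identityʳ _) ⟨
      1# * ((u * u + γ) + 0#)
        ≡⟨ cong₂ (λ a b → a * ((u * u + γ) + b)) γ*γ≡1 u+γu≡0 ⟨
      γ * γ * ((u * u + γ) + (u + γ * u))
        ≡⟨ solve 2 (λ u γ → γ :* γ :* ((u :* u :+ γ) :+ (u :+ γ :* u)) := (u :+ γ) :* (u :* γ :+ γ) :* γ) refl u γ ⟩
      (u + γ) * (u * γ + γ) * γ
        ≡⟨ cong₂ (λ e γ′ → (u + e) * (u * γ + e) * γ′) γ≡-1 (β^≡θ^*θ^ m) ⟩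
      r 0F * r 1F * (θ ^ m * θ ^ m) ∎
      where
      θ⁴ᶜ≡u*u : θ ^ (4 ℕ.* toℕ c) ≡ u * u
      θ⁴ᶜ≡u*u = trans (cong (θ ^_) (4c≡2c+2c (toℕ c)))
                      (trans (^-+ θ (2 ℕ.* toℕ c) (2 ℕ.* toℕ c)) (cong₂ _*_ (^-* θ 2 (toℕ c)) (^-* θ 2 (toℕ c))))
        where
        4c≡2c+2c : ∀ c → 4 ℕ.* c ≡ 2 ℕ.* c ℕ.+ 2 ℕ.* c
        4c≡2c+2c = solve-∀
      u+γu≡0 : u + γ * u ≡ 0#
      u+γu≡0 = trans (cong (_+ γ * u) (sym (*-identityˡ u)))
                     (trans (sym (distribʳ u 1# γ)) (trans (cong (_* u) 1+γ≡0) (zeroˡ u)))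

    IsSquare-s⇒IsSquare-r₀r₁ : IsSquare s → IsSquare (r 0F * r 1F)
    IsSquare-s⇒IsSquare-r₀r₁ = IsSquare-cancel (^-≢0 θ≢0 m) ∘ subst IsSquare s≡r₀r₁*θᵐ*θᵐ

    IsSquare-r₀r₁⇒IsSquare-s : IsSquare (r 0F * r 1F) → IsSquare s
    IsSquare-r₀r₁⇒IsSquare-s r₀r₁-square =
      subst IsSquare (sym s≡r₀r₁*θᵐ*θᵐ) (IsSquare-* r₀r₁-square (θ ^ m , refl))

    CompleteCosetReps⇒NonSquare : CompleteCosetReps H R → NonSquare s
    CompleteCosetReps⇒NonSquare (_ , representatives) =
      s≢0 , λ z z²≡s → r₀r₁-non-square (IsSquare-s⇒IsSquare-r₀r₁ (z , z²≡s))
      where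
      s≢0 : s ≢ 0#
      s≢0 = subst (_≢ 0#) (sym s≡r₀r₁*θᵐ*θᵐ)
              (*-≢0 (*-≢0 (r≢0 0F) (r≢0 1F)) (*-≢0 (^-≢0 θ≢0 m) (^-≢0 θ≢0 m)))
      r₀r₁-non-square : ¬ IsSquare (r 0F * r 1F)
      r₀r₁-non-square r₀r₁-square = contradiction (begin
        2
          ≡⟨ cong₂ (λ a b → 𝟙 a ℕ.+ (𝟙 b ℕ.+ 0)) r₀∈r₀H r₁∈r₀H ⟨
        𝟙 (coset (r 0F) H (r 0F)) ℕ.+ (𝟙 (coset (r 0F) H (r 1F)) ℕ.+ 0)
          ≡⟨ count-R∧coset (r 0F) ⟨
        count (λ i → R (elt i) ∧ coset (r 0F) H (elt i))
          ≡⟨ representatives (r 0F) (r≢0 0F) ⟩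
        1 ∎) λ ()
        where
        r₀∈r₀H : coset (r 0F) H (r 0F) ≡ true
        r₀∈r₀H = Equivalence.from (coset⇔IsSquare (r≢0 0F) (r≢0 0F)) (r 0F , refl)
        r₁∈r₀H : coset (r 0F) H (r 1F) ≡ true
        r₁∈r₀H = Equivalence.from (coset⇔IsSquare (r≢0 1F) (r≢0 0F)) (subst IsSquare (*-comm _ _) r₀r₁-square)

    NonSquare⇒CompleteCosetReps : NonSquare s → CompleteCosetReps H R
    NonSquare⇒CompleteCosetReps (_ , s-non-square) =
      R-nonzero 1≤c , λ y y≢0 → trans (count-R∧coset y) (exactly-one y≢0)
      where
      r₀y*r₁y-non-square : ∀ {y} → y ≢ 0# → ¬ IsSquare (r 0F * y * (r 1F * y))
      r₀y*r₁y-non-square {y} y≢0 =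
        (λ (z , z²≡s) → s-non-square z z²≡s) ∘ IsSquare-r₀r₁⇒IsSquare-s ∘ IsSquare-cancel y≢0
          ∘ subst IsSquare (solve 3 (λ a b y → a :* y :* (b :* y) := a :* b :* (y :* y)) refl (r 0F) (r 1F) y)
      exactly-one : ∀ {y} → y ≢ 0# → 𝟙 (coset y H (r 0F)) ℕ.+ (𝟙 (coset y H (r 1F)) ℕ.+ 0) ≡ 1
      exactly-one {y} y≢0 with coset y H (r 0F) in r₀∈? | coset y H (r 1F) in r₁∈?
      ... | true  | true  =
        contradiction (IsSquare-* (square 0F r₀∈?) (square 1F r₁∈?)) (r₀y*r₁y-non-square y≢0)
        where
        square : ∀ t → coset y H (r t) ≡ true → IsSquare (r t * y)
        square t = Equivalence.to (coset⇔IsSquare (r≢0 t) y≢0)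
      ... | true  | false = refl
      ... | false | true  = refl
      ... | false | false =
        contradiction (non-square*non-square (*-≢0 (r≢0 0F) y≢0) (*-≢0 (r≢0 1F) y≢0)
                         (non-square 0F r₀∈?) (non-square 1F r₁∈?))
                      (r₀y*r₁y-non-square y≢0)
        where
        non-square : ∀ t → coset y H (r t) ≡ false → ¬ IsSquare (r t * y)
        non-square t r∉yH square =
          contradiction (trans (sym r∉yH) (Equivalence.from (coset⇔IsSquare (r≢0 t) y≢0) square)) λ ()

    CompleteCosetReps⇔NonSquare : CompleteCosetReps H R ⇔ NonSquare s
    CompleteCosetReps⇔NonSquare = mk⇔ CompleteCosetReps⇒NonSquare NonSquare⇒CompleteCosetReps

theorem2 : (q m l : ℕ) → 2 ≤ l → 2 ≤ m → q ≡ 1 ℕ.+ m ℕ.* (l ℕ.* l) →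
    (F : FiniteField q) → let open FiniteField F in
    (θ : Carrier) → Primitive θ →
      ((c : Fin m) → 1 ≤ toℕ c →
        IsCCEDF additiveGroup m l 1 (toℕ c) (Afam m l θ)
          ⇔ CompleteCosetReps ⟨ θ ^ l ⟩ (λ x → Afam m l θ c (x + 1#)))
    × (l ≡ 2 → (c : Fin m) → 1 ≤ toℕ c →
        IsCCEDF additiveGroup m 2 1 (toℕ c) (Afam m 2 θ)
          ⇔ NonSquare ((θ ^ (4 ℕ.* toℕ c)) - 1#))
theorem2 _ m l 2≤l 2≤m refl F θ θ-primitive =
  CyclotomicFamily.IsCCEDF⇔CompleteCosetReps m l F θ θ-primitive , quadratic
  where
  instance
    m≢0 : NonZero m
    m≢0 = ℕ.>-nonZero (ℕ.<-≤-trans ℕ.z<s 2≤m)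
    l≢0 : NonZero l
    l≢0 = ℕ.>-nonZero (ℕ.<-≤-trans ℕ.z<s 2≤l)
  open FiniteField F
  quadratic : l ≡ 2 → (c : Fin m) → 1 ≤ toℕ c →
    IsCCEDF additiveGroup m 2 1 (toℕ c) (Afam m 2 θ) ⇔ NonSquare ((θ ^ (4 ℕ.* toℕ c)) - 1#)
  quadratic refl c 1≤c = ⇔-trans (CyclotomicFamily.IsCCEDF⇔CompleteCosetReps m 2 F θ θ-primitive c 1≤c)
                                 (QuadraticCase.CompleteCosetReps⇔NonSquare m F θ θ-primitive c 1≤c)
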